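{- Let $W_n$ be an orientation of the wheel graph in which the rim is a directed cycle of length $n$ (spokes oriented arbitrarily), with a $c$-coloring $c$, and let $v$ be the hub (the unique vertex of degree $n$). Then $W_n$ has an up-color kernel if and only if one of the following holds: (1) every other vertex $u$ satisfies $(u,v)\in A(W_n)$ and $c(v)$ is greater than the color of every other vertex; or (2) $n$ is even, $v$ is up-color absorbed by some vertex $w$ (i.e. $(v,w)\in A(W_n)$ and $c(v)<c(w)$), and $w$ belongs to an up-color kernel $K$ of $W_n\setminus\{v\}$.
   Context: A $c$-coloring is a function $c:V\to\{0,1,2,\ldots\}$. A set $N$ of vertices is up-color absorbent if every vertex $x\notin N$ has an out-neighbor $y\in N$ with $c(x)<c(y)$, and no vertex of $N$ has color $0$. An up-color kernel is an independent up-color absorbent set. -}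

module Defs where

open import Data.Nat using (ℕ; suc; _+_; _<_; NonZero)
open import Data.Nat.DivMod using (_mod_)
open import Data.Fin using (Fin; toℕ)
open import Data.Bool using (Bool; true; false)
open import Data.Product using (Σ; _×_)
open import Relation.Binary.PropositionalEquality using (_≡_; _≢_)
open import Relation.Nullary using (¬_)

UpColorAbsorbent : {V : Set} → (V → V → Set) → (V → ℕ) → (V → Bool) → Set
UpColorAbsorbent {V} Arc c N =
  ((x : V) → N x ≡ false → Σ V (λ y → Arc x y × N y ≡ true × c x < c y))
  × ((x : V) → N x ≡ true → c x ≢ 0)

Independent : {V : Set} → (V → V → Set) → (V → Bool) → Set
Independent {V} Arc N = (x y : V) → N x ≡ true → N y ≡ true → ¬ Arc x y

UpColorKernel : {V : Set} → (V → V → Set) → (V → ℕ) → (V → Bool) → Set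
UpColorKernel Arc c N = Independent Arc N × UpColorAbsorbent Arc c N

data WV (n : ℕ) : Set where
  hub : WV n
  rim : Fin n → WV n

next : {n : ℕ} .{{_ : NonZero n}} → Fin n → Fin n
next {n} i = suc (toℕ i) mod n

-- arcs of the directed rim cycle (this is W_n ∖ {hub})
RimArc : (n : ℕ) .{{_ : NonZero n}} → Fin n → Fin n → Set
RimArc n i j = j ≡ next i

data WArc (n : ℕ) .{{_ : NonZero n}} (spoke : Fin n → Bool) : WV n → WV n → Set where
  rimArc : (i j : Fin n) → RimArc n i j → WArc n spoke (rim i) (rim j)
  inArc  : (i : Fin n) → spoke i ≡ true → WArc n spoke (rim i) hub
  outArc : (i : Fin n) → spoke i ≡ false → WArc n spoke hub (rim i)

{-# OPTIONS --safe #-}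
module Submission where

-- If the hub lies in a kernel, independence keeps every rim vertex out of it,
-- so each rim vertex must be up-absorbed by the hub: condition (1). Otherwise
-- the hub is up-absorbed by some rim vertex w of the kernel, and the kernel
-- restricted to the rim is an up-color kernel of the directed rim cycle. On a
-- directed cycle a kernel alternates along the arcs (independence forbids two
-- consecutive members, absorption forbids two consecutive non-members), which
-- forces n to be even: condition (2). Conversely, the hub alone, resp. the rim
-- kernel K, is an up-color kernel of the wheel.

open import Defs
open import Data.Nat using (ℕ; zero; suc; _+_; _≤_; _<_; _%_; NonZero)
open import Data.Nat.Properties using (m<n⇒n≢0)
open import Data.Nat.DivMod using (_mod_; m%n<n; m%n%n≡m%n; %-distribˡ-+; [m+n]%n≡m%n)
open import Data.Nat.Divisibility using (_∣_; _∣0; ∣-refl; ∣m∣n⇒∣m+n)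
open import Data.Fin using (Fin; toℕ)
open import Data.Fin.Properties using (toℕ-fromℕ<; fromℕ<-cong)
open import Data.Bool using (Bool; true; false; not)
open import Data.Bool.Properties using (not-injective; not-involutive; not-¬; ¬-not)
open import Data.Empty using (⊥-elim)
open import Data.Product using (Σ; _×_; _,_; proj₁; proj₂)
open import Data.Sum using (_⊎_; inj₁; inj₂; [_,_])
open import Function using (_∘_)
open import Function.Bundles using (_⇔_; mk⇔)
open import Relation.Binary.PropositionalEquality using (_≡_; _≢_; refl; sym; trans; cong; module ≡-Reasoning)

Alternates : (ℕ → Bool) → Set
Alternates g = ∀ k → g (suc k) ≡ not (g k)

alternates⇒2∣ : ∀ {g} → Alternates g → ∀ k → g k ≡ g 0 → 2 ∣ k
alternates⇒2∣ {g} alt k = proj₁ (parity k)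
  where
  parity : ∀ k → (g k ≡ g 0 → 2 ∣ k) × (g k ≡ not (g 0) → 2 ∣ suc k)
  parity zero = (λ _ → 2 ∣0) , λ g0≡not-g0 → ⊥-elim (not-¬ refl g0≡not-g0)
  parity (suc k) = agrees , disagrees
    where
    agrees : g (suc k) ≡ g 0 → 2 ∣ suc k
    agrees e = proj₂ (parity k) (not-injective (trans (sym (alt k)) (trans e (sym (not-involutive (g 0))))))
    disagrees : g (suc k) ≡ not (g 0) → 2 ∣ suc (suc k)
    disagrees e = ∣m∣n⇒∣m+n ∣-refl (proj₁ (parity k) (not-injective (trans (sym (alt k)) e)))

module _ {n : ℕ} .{{_ : NonZero n}} where

  next-mod : ∀ k → next (k mod n) ≡ suc k mod n
  next-mod k = fromℕ<-cong _ _ suc[k%n]%n≡suc[k]%n _ _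
    where
    open ≡-Reasoning
    suc[k%n]%n≡suc[k]%n : suc (toℕ (k mod n)) % n ≡ suc k % n
    suc[k%n]%n≡suc[k]%n = begin
      suc (toℕ (k mod n)) % n     ≡⟨ cong (λ m → suc m % n) (toℕ-fromℕ< (m%n<n k n)) ⟩
      (1 + k % n) % n             ≡⟨ %-distribˡ-+ 1 (k % n) n ⟩
      (1 % n + k % n % n) % n     ≡⟨ cong (λ m → (1 % n + m) % n) (m%n%n≡m%n k n) ⟩
      (1 % n + k % n) % n         ≡⟨ %-distribˡ-+ 1 k n ⟨
      suc k % n                   ∎

  alternatesOnCycle⇒2∣n : (K : Fin n → Bool) → (∀ i → K (next i) ≡ not (K i)) → 2 ∣ n
  alternatesOnCycle⇒2∣n K alt =
    alternates⇒2∣ (λ k → trans (cong K (sym (next-mod k))) (alt (k mod n))) n (cong K n-mod-n)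
    where
    n-mod-n : n mod n ≡ 0 mod n
    n-mod-n = fromℕ<-cong (n % n) (0 % n) ([m+n]%n≡m%n 0 n) _ _

  upColorKernel-alternates : ∀ {c K} → UpColorKernel (RimArc n) c K → ∀ i → K (next i) ≡ not (K i)
  upColorKernel-alternates {K = K} (ind , abs , _) i with K i in Ki
  ... | true  = ¬-not (λ Knext → ind i (next i) Ki Knext refl)
  ... | false with abs i Ki
  ...   | _ , refl , Knext , _ = Knext

  rimUpColorKernel⇒2∣n : ∀ {c K} → UpColorKernel (RimArc n) c K → 2 ∣ n
  rimUpColorKernel⇒2∣n {K = K} κ = alternatesOnCycle⇒2∣n K (upColorKernel-alternates κ)

module Wheel (n : ℕ) .{{_ : NonZero n}} (spoke : Fin n → Bool) (c : WV n → ℕ) where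

  RimAbsorbedByHub : Set
  RimAbsorbedByHub = ∀ i → WArc n spoke (rim i) hub × c (rim i) < c hub

  HubAbsorbedByRimKernel : Set
  HubAbsorbedByRimKernel =
    Σ (Fin n) λ w → WArc n spoke hub (rim w) × c hub < c (rim w)
      × Σ (Fin n → Bool) λ K → UpColorKernel (RimArc n) (c ∘ rim) K × K w ≡ true

  hub-adjacent : ∀ i → WArc n spoke (rim i) hub ⊎ WArc n spoke hub (rim i)
  hub-adjacent i with spoke i in s
  ... | true  = inj₁ (inArc i s)
  ... | false = inj₂ (outArc i s)

  hub∈⇒rim∉ : ∀ {N} → Independent (WArc n spoke) N → N hub ≡ true → ∀ i → N (rim i) ≡ false
  hub∈⇒rim∉ ind Nhub i = ¬-not λ Nrim → [ ind _ _ Nrim Nhub , ind _ _ Nhub Nrim ] (hub-adjacent i)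

  hub∈⇒rimAbsorbedByHub : ∀ {N} → UpColorKernel (WArc n spoke) c N → N hub ≡ true → RimAbsorbedByHub
  hub∈⇒rimAbsorbedByHub (ind , abs , _) Nhub i with abs (rim i) (hub∈⇒rim∉ ind Nhub i)
  ... | hub   , arc , _  , lt = arc , lt
  ... | rim j , _   , Nj , _  = ⊥-elim (not-¬ Nj (hub∈⇒rim∉ ind Nhub j))

  hub∉⇒rimUpColorKernel : ∀ {N} → UpColorKernel (WArc n spoke) c N → N hub ≡ false →
                          UpColorKernel (RimArc n) (c ∘ rim) (N ∘ rim)
  hub∉⇒rimUpColorKernel {N} (ind , abs , nz) Nhub =
    (λ x y Nx Ny r → ind _ _ Nx Ny (rimArc x y r)) , absorbedInRim , nz ∘ rim
    where
    absorbedInRim : ∀ x → N (rim x) ≡ false →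
                    Σ (Fin n) λ y → RimArc n x y × N (rim y) ≡ true × c (rim x) < c (rim y)
    absorbedInRim x Nx with abs (rim x) Nx
    ... | hub   , _                , N-hub , _  = ⊥-elim (not-¬ N-hub Nhub)
    ... | rim y , rimArc _ _ x→y , Ny    , lt = y , x→y , Ny , lt

  hub∉⇒hubAbsorbedByRimKernel : ∀ {N} → UpColorKernel (WArc n spoke) c N → N hub ≡ false →
                                HubAbsorbedByRimKernel
  hub∉⇒hubAbsorbedByRimKernel {N} κ@(_ , abs , _) Nhub with abs hub Nhub
  ... | hub   , ()  , _
  ... | rim w , arc , Nw , lt = w , arc , lt , N ∘ rim , hub∉⇒rimUpColorKernel κ Nhub , Nw

  upColorKernel⇒cases : ∀ {N} → UpColorKernel (WArc n spoke) c N →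
                        RimAbsorbedByHub ⊎ (2 ∣ n × HubAbsorbedByRimKernel)
  upColorKernel⇒cases {N} κ with N hub in Nhub
  ... | true  = inj₁ (hub∈⇒rimAbsorbedByHub κ Nhub)
  ... | false = inj₂ ( rimUpColorKernel⇒2∣n (hub∉⇒rimUpColorKernel κ Nhub)
                     , hub∉⇒hubAbsorbedByRimKernel κ Nhub)

  hubOnly : WV n → Bool
  hubOnly hub     = true
  hubOnly (rim _) = false

  hubOnly-upColorKernel : RimAbsorbedByHub → UpColorKernel (WArc n spoke) c hubOnly
  hubOnly-upColorKernel absorbed = independent , (absorbent , nonzero)
    where
    independent : Independent (WArc n spoke) hubOnly
    independent hub     hub     _ _ ()
    independent hub     (rim _) _ ()
    independent (rim _) _       ()
    absorbent : ∀ x → hubOnly x ≡ false → Σ (WV n) λ y → WArc n spoke x y × hubOnly y ≡ true × c x < c y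
    absorbent (rim i) _ = hub , proj₁ (absorbed i) , refl , proj₂ (absorbed i)
    nonzero : ∀ x → hubOnly x ≡ true → c x ≢ 0
    nonzero hub _ = m<n⇒n≢0 (proj₂ (absorbed (0 mod n)))

  withoutHub : (Fin n → Bool) → WV n → Bool
  withoutHub _ hub     = false
  withoutHub K (rim i) = K i

  withoutHub-upColorKernel : ∀ {K w} → WArc n spoke hub (rim w) → c hub < c (rim w) →
                             UpColorKernel (RimArc n) (c ∘ rim) K → K w ≡ true →
                             UpColorKernel (WArc n spoke) c (withoutHub K)
  withoutHub-upColorKernel {K} {w} hub→w lt (ind , abs , nz) Kw = independent , (absorbent , nonzero)
    where
    independent : Independent (WArc n spoke) (withoutHub K)
    independent (rim x) (rim y) Kx Ky (rimArc _ _ x→y) = ind x y Kx Ky x→y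
    absorbent : ∀ x → withoutHub K x ≡ false →
                Σ (WV n) λ y → WArc n spoke x y × withoutHub K y ≡ true × c x < c y
    absorbent hub _ = rim w , hub→w , Kw , lt
    absorbent (rim x) Kx with abs x Kx
    ... | y , x→y , Ky , lt′ = rim y , rimArc x y x→y , Ky , lt′
    nonzero : ∀ x → withoutHub K x ≡ true → c x ≢ 0
    nonzero (rim x) = nz x

  cases⇒upColorKernel : RimAbsorbedByHub ⊎ (2 ∣ n × HubAbsorbedByRimKernel) →
                        Σ (WV n → Bool) λ N → UpColorKernel (WArc n spoke) c N
  cases⇒upColorKernel (inj₁ absorbed) = hubOnly , hubOnly-upColorKernel absorbed
  cases⇒upColorKernel (inj₂ (_ , w , hub→w , lt , K , κ , Kw)) =
    withoutHub K , withoutHub-upColorKernel hub→w lt κ Kw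

-- The characterisation holds for every n ≥ 1.
mainTheorem10 : (n : ℕ) .{{_ : NonZero n}} → 3 ≤ n →
    (spoke : Fin n → Bool) (c : WV n → ℕ) →
    (Σ (WV n → Bool) (λ N → UpColorKernel (WArc n spoke) c N))
    ⇔ (((i : Fin n) → WArc n spoke (rim i) hub × c (rim i) < c hub)
      ⊎ (2 ∣ n × Σ (Fin n) (λ w → WArc n spoke hub (rim w) × c hub < c (rim w)
          × Σ (Fin n → Bool) (λ K → UpColorKernel (RimArc n) (λ i → c (rim i)) K × K w ≡ true))))
mainTheorem10 n _ spoke c = mk⇔ (λ (_ , κ) → upColorKernel⇒cases κ) cases⇒upColorKernel
  where open Wheel n spoke c
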